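{- Let $n$ be a natural number and let $\sigma$ be a state whose type is one of $(1,0,0,n)$, $(0,1,0,n)$, $(0,0,1,n)$, $(0,0,0,n)$. Then $\sigma$ is $4$-interval nice.
   Context: Setting: $\mathcal U=\{0,\dots,2^m-1\}$, viewed cyclically, and the game allows $3$ lies. States: a state is a map $\sigma:\mathcal U\to\{0,\dots,4\}$ of type $(|\sigma^{ -1}(0)|,\dots,|\sigma^{ -1}(3)|)$. Its support is $\Sigma=\{y:\sigma(y)\le3\}$, and it is final if $|\Sigma|\le1$. Answers: $\sigma_{yes}(y)=\min\{\sigma(y)+[y\notin Q],4\}$ and $\sigma_{no}(y)=\min\{\sigma(y)+[y\in Q],4\}$. Character: $w_q(\sigma)=\sum_{j=0}^3|\sigma^{ -1}(j)|\sum_{\ell=0}^{3-j}\binom q\ell$ and $\mathrm{ch}(\sigma)=\min\{q\ge 0:w_q(\sigma)\le 2^q\}$. Strategies: a strategy of size $q$ is a complete binary tree of depth $q$ with questions at internal nodes. It is winning for $\sigma$ if all leaf states reached from $\sigma$ are final. Intervals: an interval is empty or a set of cyclically consecutive elements of $\mathcal U$. A $4$-interval question is a union of at most four intervals. Well shaped: order $\Sigma$ cyclically. The state is well shaped if $\Sigma$ splits into twelve possibly empty sets of cyclically consecutive elements of $\Sigma$, in cyclic order, on which $\sigma$ is constant with values either $2,1,0,1,2,3,2,1,2,3,2,3$ or $2,1,0,1,2,1,2,3,2,3,2,3$. 4-interval nice: $\sigma$ is $4$-interval nice if it is well shaped and some strategy of size $\mathrm{ch}(\sigma)$ that is winning for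 $\sigma$ uses only $4$-interval questions. -}

module Defs where

open import Data.Nat using (ℕ; zero; suc; _+_; _*_; _^_; _≤_; _<_; _≟_)
open import Data.Nat.Combinatorics using (_C_)
open import Data.Fin using (Fin; toℕ)
open import Data.Bool using (Bool; true; false; if_then_else_)
import Data.Bool as B
open import Data.List using (List; []; _∷_; _++_; length; filter; map; replicate)
open import Data.List.Relation.Unary.Any using (Any)
open import Data.Vec using (Vec; []; _∷_)
open import Data.Vec.Functional using () renaming (toList to vtoList)
open import Data.Fin using () renaming (toℕ to finToℕ)
open import Data.Product using (Σ; _×_; _,_; ∃)
open import Data.Sum using (_⊎_)
open import Relation.Nullary using (does)
open import Relation.Binary.PropositionalEquality using (_≡_)
open import Data.Nat using (_≤?_)
import Data.Fin as F
open import Data.List using () renaming (allFin to allFinL)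

-- The universe U = {0, ..., N-1} with N = 2^m; elements are Fin N,
-- ordered by their natural value (cyclic order 0,1,...,N-1,0,...).

State : ℕ → Set
State N = Fin N → Fin 5

val : ∀ {N} → State N → Fin N → ℕ
val σ x = toℕ (σ x)

count : ∀ {N} → State N → ℕ → ℕ
count {N} σ j = length (filter (λ x → val σ x ≟ j) (allFinL N))

HasType : ∀ {N} → State N → ℕ → ℕ → ℕ → ℕ → Set
HasType σ a b c d =
  count σ 0 ≡ a × count σ 1 ≡ b × count σ 2 ≡ c × count σ 3 ≡ d

support : ∀ {N} → State N → List (Fin N)
support {N} σ = filter (λ x → val σ x ≤? 3) (allFinL N)

Final : ∀ {N} → State N → Set
Final σ = length (support σ) ≤ 1

Question : ℕ → Set
Question N = Fin N → Bool

bump : Fin 5 → Fin 5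
bump F.zero = F.suc F.zero
bump (F.suc F.zero) = F.suc (F.suc F.zero)
bump (F.suc (F.suc F.zero)) = F.suc (F.suc (F.suc F.zero))
bump (F.suc (F.suc (F.suc F.zero))) = F.suc (F.suc (F.suc (F.suc F.zero)))
bump (F.suc (F.suc (F.suc (F.suc F.zero)))) = F.suc (F.suc (F.suc (F.suc F.zero)))

σyes : ∀ {N} → State N → Question N → State N
σyes σ Q y = if Q y then σ y else bump (σ y)

σno : ∀ {N} → State N → Question N → State N
σno σ Q y = if Q y then bump (σ y) else σ y

-- strategies of size q: complete binary trees of depth q with a
-- question at every internal node (left subtree = after answer yes,
-- right subtree = after answer no)
data Strategy (N : ℕ) : ℕ → Set where
  leaf : Strategy N 0
  node : ∀ {q} → Question N → Strategy N q → Strategy N q → Strategy N (suc q)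

Winning : ∀ {N q} → State N → Strategy N q → Set
Winning σ leaf = Final σ
Winning σ (node Q s t) = Winning (σyes σ Q) s × Winning (σno σ Q) t

-- membership in the cyclic interval starting at a of length len
-- (len = 0 gives the empty interval; len ≤ N):
-- x ∈ {a, a+1, ..., a+len-1} (mod N)
InCyc : ℕ → ℕ → ℕ → ℕ → Set
InCyc N a len x = (a ≤ x × x < a + len) ⊎ (a ≤ x + N × x + N < a + len)

record Interval (N : ℕ) : Set where
  constructor interval
  field
    start  : ℕ
    len    : ℕ
    start< : start < N
    len≤   : len ≤ N

_∈I_ : ∀ {N} → Fin N → Interval N → Set
_∈I_ {N} x I = InCyc N (Interval.start I) (Interval.len I) (toℕ x)

-- a 4-interval question: union of at most four intervals
-- (empty intervals allowed, so exactly four intervals suffice)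
FourInterval : ∀ {N} → Question N → Set
FourInterval {N} Q =
  Σ (Interval N) λ I₁ → Σ (Interval N) λ I₂ →
  Σ (Interval N) λ I₃ → Σ (Interval N) λ I₄ →
  ∀ x → (Q x ≡ true → (x ∈I I₁) ⊎ (x ∈I I₂) ⊎ (x ∈I I₃) ⊎ (x ∈I I₄))
      × ((x ∈I I₁) ⊎ (x ∈I I₂) ⊎ (x ∈I I₃) ⊎ (x ∈I I₄) → Q x ≡ true)

Uses4Interval : ∀ {N q} → Strategy N q → Set
Uses4Interval leaf = Data.Unit.⊤
  where import Data.Unit
Uses4Interval (node Q s t) = FourInterval Q × Uses4Interval s × Uses4Interval t

binSum : ℕ → ℕ → ℕ
binSum q zero = q C 0
binSum q (suc k) = binSum q k + q C (suc k)

weight : ∀ {N} → ℕ → State N → ℕ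
weight q σ =
  count σ 0 * binSum q 3 + count σ 1 * binSum q 2
  + count σ 2 * binSum q 1 + count σ 3 * binSum q 0

IsCh : ∀ {N} → State N → ℕ → Set
IsCh σ q = weight q σ ≤ 2 ^ q × (∀ p → p < q → 2 ^ p < weight p σ)

blocks : ∀ {k} → Vec ℕ k → Vec ℕ k → List ℕ
blocks [] [] = []
blocks (l ∷ ls) (v ∷ vs) = replicate l v ++ blocks ls vs

pattern₁ : Vec ℕ 12
pattern₁ = 2 ∷ 1 ∷ 0 ∷ 1 ∷ 2 ∷ 3 ∷ 2 ∷ 1 ∷ 2 ∷ 3 ∷ 2 ∷ 3 ∷ []

pattern₂ : Vec ℕ 12
pattern₂ = 2 ∷ 1 ∷ 0 ∷ 1 ∷ 2 ∷ 1 ∷ 2 ∷ 3 ∷ 2 ∷ 3 ∷ 2 ∷ 3 ∷ []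

supportValues : ∀ {N} → State N → List ℕ
supportValues σ = map (val σ) (support σ)

-- well shaped: some cyclic rotation of the support (i.e. a choice of
-- starting point in the cyclic order) splits into twelve consecutive,
-- possibly empty blocks on which σ takes the pattern values
WellShaped : ∀ {N} → State N → Set
WellShaped σ =
  Σ (List ℕ) λ xs → Σ (List ℕ) λ ys → supportValues σ ≡ xs ++ ys ×
  Σ (Vec ℕ 12) λ ls →
    (ys ++ xs ≡ blocks ls pattern₁) ⊎ (ys ++ xs ≡ blocks ls pattern₂)

FourIntervalNice : ∀ {N} → State N → Set
FourIntervalNice {N} σ =
  WellShaped σ ×
  Σ ℕ λ q → IsCh σ q ×
  Σ (Strategy N q) λ S → Winning σ S × Uses4Interval S

-- Such a state has at most one element e of value below 3; every other element has value 3 or 4.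
-- An element of value 3 contributes 1 to every w_q, so w_q(σ) = W(σ e, q) + k with k the number
-- of other elements of value 3 and W(v, q) = Σ_{ℓ ≤ 3-v} C(q, ℓ). Ask the 2-interval question
-- Q = {e} ∪ [0, s): e keeps its value on the yes side and is bumped on the no side, while every
-- other 3 survives exactly on the side of its answer. Pascal's rule W(v, q+1) = W(v, q) + W(v+1, q)
-- gives Berlekamp's conservation law w_{q+1}(σ) = w_q(σ_yes) + w_q(σ_no), and since the number of
-- 3's inside [0, s) grows by at most one with each step of s, some s gives both sides weight at
-- most 2^q. Induction on q = ch(σ) then yields a winning strategy made of such questions. The
-- values along the support are all 3 except possibly one, so σ is also well shaped.
module Submission where

open import Data.Bool using (Bool; true; false; if_then_else_; _∨_)
open import Data.Bool.Properties using (∨-zeroʳ; if-eta; if-float; if-cong-else)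
open import Data.Empty using (⊥-elim)
open import Data.Fin as F using (Fin; toℕ)
open import Data.Fin.Patterns using (0F; 1F; 2F; 3F; 4F)
open import Data.Fin.Properties using (punchInᵢ≢i; toℕ<n; toℕ-injective; all?; ¬∀⟶∃¬)
open import Data.List using (List; []; _∷_; _++_; length; filter; map; replicate; tabulate)
open import Data.List.Properties using (++-identityʳ)
open import Data.List.Relation.Unary.All using (All; []; _∷_)
open import Data.List.Relation.Unary.All.Properties using (++⁺)
open import Data.Nat using (ℕ; zero; suc; _+_; _*_; _∸_; _^_; _⊓_; _≤_; _<_; _≟_; _≤?_; _<?_; z≤n; s≤s)
open import Data.Nat.Combinatorics using (_C_; nCk≡nC[n∸k]; nCn≡1; nCk+nC[k+1]≡[n+1]C[k+1])
open import Data.Nat.Properties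
open import Data.Nat.Solver using (module +-*-Solver)
open import Data.Product using (Σ; ∃-syntax; _×_; _,_; proj₁; proj₂)
open import Data.Sum using (_⊎_; inj₁; inj₂)
open import Data.Unit using (tt)
open import Data.Vec using ([]; _∷_)
open import Data.Vec.Functional using (removeAt)
open import Function using (_∘_; id)
open import Relation.Binary.PropositionalEquality
open import Relation.Nullary using (does; ¬_; yes; no; Dec; contradiction)
open import Relation.Nullary.Decidable using (dec-true; dec-false)
open import Relation.Unary using (Pred; Decidable)

open import Algebra.Properties.Semiring.Sum +-*-semiring
  using (sum; sum-cong-≗; sum-replicate-zero; ∑-distrib-+; *-distribʳ-sum; sum-remove)

open import Defs

fromBool : Bool → ℕ
fromBool true = 1
fromBool false = 0

length-filter-tabulate : ∀ {a p} {A : Set a} {P : Pred A p} (P? : Decidable P) {N} (g : Fin N → A) →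
  length (filter P? (tabulate g)) ≡ sum (λ i → fromBool (does (P? (g i))))
length-filter-tabulate P? {zero} g = refl
length-filter-tabulate P? {suc N} g with does (P? (g 0F))
... | true = cong suc (length-filter-tabulate P? (g ∘ F.suc))
... | false = length-filter-tabulate P? (g ∘ F.suc)

count≡sum : ∀ {N} (σ : State N) j → count σ j ≡ sum (λ x → fromBool (does (val σ x ≟ j)))
count≡sum σ j = length-filter-tabulate (λ x → val σ x ≟ j) id

sum≡0⇒≡0 : ∀ {N} (f : Fin N → ℕ) → sum f ≡ 0 → ∀ x → f x ≡ 0
sum≡0⇒≡0 f sum≡0 0F = m+n≡0⇒m≡0 (f 0F) sum≡0
sum≡0⇒≡0 f sum≡0 (F.suc x) = sum≡0⇒≡0 (f ∘ F.suc) (m+n≡0⇒n≡0 (f 0F) sum≡0) x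

dropAt : ∀ {N} → Fin N → (Fin N → ℕ) → Fin N → ℕ
dropAt e f x = if does (x F.≟ e) then 0 else f x

dropAt-self : ∀ {N} (e : Fin N) (f : Fin N → ℕ) → dropAt e f e ≡ 0
dropAt-self e f rewrite dec-true (e F.≟ e) refl = refl

dropAt-≢ : ∀ {N} {e x : Fin N} (f : Fin N → ℕ) → x ≢ e → dropAt e f x ≡ f x
dropAt-≢ {e = e} {x} f x≢e rewrite dec-false (x F.≟ e) x≢e = refl

dropAt-cong : ∀ {N} (e : Fin N) {f g : Fin N → ℕ} → (∀ x → x ≢ e → f x ≡ g x) →
  ∀ x → dropAt e f x ≡ dropAt e g x
dropAt-cong e f≡g x with x F.≟ e
... | yes _ = refl
... | no x≢e = f≡g x x≢e

dropAt-≤ : ∀ {N} (e : Fin N) {f : Fin N → ℕ} {c} → (∀ x → f x ≤ c) → ∀ x → dropAt e f x ≤ c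
dropAt-≤ e f≤c x with x F.≟ e
... | yes _ = z≤n
... | no _ = f≤c x

sum-dropAt : ∀ {N} (e : Fin N) (f : Fin N → ℕ) → sum f ≡ f e + sum (dropAt e f)
sum-dropAt {suc N} e f = begin
    sum f
  ≡⟨ sum-remove {i = e} f ⟩
    f e + sum (removeAt f e)
  ≡⟨ cong (f e +_) (sum-cong-≗ (λ i → sym (dropAt-≢ f (punchInᵢ≢i e i)))) ⟩
    f e + sum (removeAt (dropAt e f) e)
  ≡⟨ cong (f e +_) (sym (trans (sum-remove {i = e} (dropAt e f))
                               (cong (_+ sum (removeAt (dropAt e f) e)) (dropAt-self e f)))) ⟩
    f e + sum (dropAt e f)
  ∎
  where open ≡-Reasoning

nC0≡1 : ∀ n → n C 0 ≡ 1
nC0≡1 n = trans (nCk≡nC[n∸k] {0} {n} z≤n) (nCn≡1 n)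

binSum-pascal : ∀ q k → binSum (suc q) (suc k) ≡ binSum q (suc k) + binSum q k
binSum-pascal q zero
  rewrite nC0≡1 (suc q) | sym (nCk+nC[k+1]≡[n+1]C[k+1] q 0) | nC0≡1 q = +-comm 1 (1 + q C 1)
binSum-pascal q (suc k)
  rewrite binSum-pascal q k | sym (nCk+nC[k+1]≡[n+1]C[k+1] q (suc k)) =
  solve 3 (λ a b c → ((a :+ b) :+ a) :+ (b :+ c) := ((a :+ b) :+ c) :+ (a :+ b)) refl
    (binSum q k) (q C suc k) (q C suc (suc k))
  where open +-*-Solver

binSum≤2^ : ∀ q k → binSum q k ≤ 2 ^ q
binSum≤2^ q zero = subst (_≤ 2 ^ q) (sym (nC0≡1 q)) (m^n>0 2 q)
binSum≤2^ zero (suc k) = subst (_≤ 1) (sym (+-identityʳ (binSum 0 k))) (binSum≤2^ zero k)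
binSum≤2^ (suc q) (suc k) rewrite binSum-pascal q k | +-identityʳ (2 ^ q) =
  +-mono-≤ (binSum≤2^ q (suc k)) (binSum≤2^ q k)

binSum-mono : ∀ q {k l} → k ≤ l → binSum q k ≤ binSum q l
binSum-mono q {k} {zero} z≤n = ≤-refl
binSum-mono q {k} {suc l} k≤1+l with m≤n⇒m<n∨m≡n k≤1+l
... | inj₁ (s≤s k≤l) = ≤-trans (binSum-mono q k≤l) (m≤m+n _ _)
... | inj₂ refl = ≤-refl

[3+t]C3>0 : ∀ t → 1 ≤ (3 + t) C 3
[3+t]C3>0 zero = ≤-refl
[3+t]C3>0 (suc t) = ≤-trans ([3+t]C3>0 t) (≤-trans (m≤n+m _ ((3 + t) C 2))
  (≤-reflexive (nCk+nC[k+1]≡[n+1]C[k+1] (3 + t) 2)))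

binSum3+t≤2^ : ∀ t → binSum (3 + t) 3 + t ≤ 2 ^ (3 + t)
binSum3+t≤2^ zero = ≤-refl
binSum3+t≤2^ (suc t) = begin
    binSum (4 + t) 3 + suc t
  ≡⟨ cong (_+ suc t) (binSum-pascal (3 + t) 2) ⟩
    B3 + B2 + suc t
  ≡⟨ solve 3 (λ a b t → (a :+ b) :+ (con 1 :+ t) := (a :+ t) :+ (b :+ con 1)) refl B3 B2 t ⟩
    (B3 + t) + (B2 + 1)
  ≤⟨ +-mono-≤ (binSum3+t≤2^ t) B2+1≤P ⟩
    P + P
  ≡⟨ cong (P +_) (sym (+-identityʳ P)) ⟩
    2 ^ (4 + t)
  ∎
  where
  open ≤-Reasoning
  open +-*-Solver
  B3 = binSum (3 + t) 3
  B2 = binSum (3 + t) 2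
  P = 2 ^ (3 + t)
  B2+1≤P : B2 + 1 ≤ P
  B2+1≤P = ≤-trans (+-monoʳ-≤ B2 ([3+t]C3>0 t)) (binSum≤2^ (3 + t) 3)

elemWeight : Fin 5 → ℕ → ℕ
elemWeight 0F q = binSum q 3
elemWeight 1F q = binSum q 2
elemWeight 2F q = binSum q 1
elemWeight 3F q = binSum q 0
elemWeight 4F q = 0

elemWeight-pascal : ∀ v q → elemWeight v (suc q) ≡ elemWeight v q + elemWeight (bump v) q
elemWeight-pascal 0F q = binSum-pascal q 2
elemWeight-pascal 1F q = binSum-pascal q 1
elemWeight-pascal 2F q = binSum-pascal q 0
elemWeight-pascal 3F q = trans (nC0≡1 (suc q)) (cong (_+ 0) (sym (nC0≡1 q)))
elemWeight-pascal 4F q = refl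

elemWeight≤binSum3 : ∀ v q → elemWeight v q ≤ binSum q 3
elemWeight≤binSum3 0F q = ≤-refl
elemWeight≤binSum3 1F q = binSum-mono q {2} {3} (s≤s (s≤s z≤n))
elemWeight≤binSum3 2F q = binSum-mono q {1} {3} (s≤s z≤n)
elemWeight≤binSum3 3F q = binSum-mono q {0} {3} z≤n
elemWeight≤binSum3 4F q = z≤n

elemWeight≤2^ : ∀ v q → elemWeight v q ≤ 2 ^ q
elemWeight≤2^ v q = ≤-trans (elemWeight≤binSum3 v q) (binSum≤2^ q 3)

elemWeight0≤1 : ∀ v → elemWeight v 0 ≤ 1
elemWeight0≤1 0F = ≤-refl
elemWeight0≤1 1F = ≤-refl
elemWeight0≤1 2F = ≤-refl
elemWeight0≤1 3F = ≤-refl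
elemWeight0≤1 4F = z≤n

weight≡sum : ∀ {N} q (σ : State N) → weight q σ ≡ sum (λ x → elemWeight (σ x) q)
weight≡sum {N} q σ = begin
    weight q σ
  ≡⟨ cong₂ _+_ (cong₂ _+_ (cong₂ _+_ (cong (_* B 3) (count≡sum σ 0)) (cong (_* B 2) (count≡sum σ 1)))
                          (cong (_* B 1) (count≡sum σ 2))) (cong (_* B 0) (count≡sum σ 3)) ⟩
    sum (c 0) * B 3 + sum (c 1) * B 2 + sum (c 2) * B 1 + sum (c 3) * B 0
  ≡⟨ cong₂ _+_ (cong₂ _+_ (cong₂ _+_ (*-distribʳ-sum (B 3) (c 0)) (*-distribʳ-sum (B 2) (c 1)))
                          (*-distribʳ-sum (B 1) (c 2))) (*-distribʳ-sum (B 0) (c 3)) ⟩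
    sum (t 0 3) + sum (t 1 2) + sum (t 2 1) + sum (t 3 0)
  ≡⟨ sym (trans (∑-distrib-+ (λ x → t 0 3 x + t 1 2 x + t 2 1 x) (t 3 0))
         (cong (_+ sum (t 3 0)) (trans (∑-distrib-+ (λ x → t 0 3 x + t 1 2 x) (t 2 1))
         (cong (_+ sum (t 2 1)) (∑-distrib-+ (t 0 3) (t 1 2)))))) ⟩
    sum (λ x → t 0 3 x + t 1 2 x + t 2 1 x + t 3 0 x)
  ≡⟨ sum-cong-≗ (λ x → pointwise (σ x)) ⟩
    sum (λ x → elemWeight (σ x) q)
  ∎
  where
  open ≡-Reasoning
  open +-*-Solver
  B = binSum q
  c : ℕ → Fin N → ℕ
  c j x = fromBool (does (val σ x ≟ j))
  t : ℕ → ℕ → Fin N → ℕ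
  t j k x = c j x * B k
  pointwise : ∀ v → fromBool (does (toℕ v ≟ 0)) * B 3 + fromBool (does (toℕ v ≟ 1)) * B 2
    + fromBool (does (toℕ v ≟ 2)) * B 1 + fromBool (does (toℕ v ≟ 3)) * B 0 ≡ elemWeight v q
  pointwise 0F = solve 4 (λ a b c d → con 1 :* a :+ con 0 :* b :+ con 0 :* c :+ con 0 :* d := a) refl
    (B 3) (B 2) (B 1) (B 0)
  pointwise 1F = solve 4 (λ a b c d → con 0 :* a :+ con 1 :* b :+ con 0 :* c :+ con 0 :* d := b) refl
    (B 3) (B 2) (B 1) (B 0)
  pointwise 2F = solve 4 (λ a b c d → con 0 :* a :+ con 0 :* b :+ con 1 :* c :+ con 0 :* d := c) refl
    (B 3) (B 2) (B 1) (B 0)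
  pointwise 3F = +-identityʳ (B 0)
  pointwise 4F = refl

weight-conservation : ∀ {N} q (σ : State N) (Q : Question N) →
  weight (suc q) σ ≡ weight q (σyes σ Q) + weight q (σno σ Q)
weight-conservation q σ Q = begin
    weight (suc q) σ
  ≡⟨ weight≡sum (suc q) σ ⟩
    sum (λ x → elemWeight (σ x) (suc q))
  ≡⟨ sum-cong-≗ (λ x → split (Q x) (σ x)) ⟩
    sum (λ x → elemWeight (σyes σ Q x) q + elemWeight (σno σ Q x) q)
  ≡⟨ ∑-distrib-+ (λ x → elemWeight (σyes σ Q x) q) (λ x → elemWeight (σno σ Q x) q) ⟩
    sum (λ x → elemWeight (σyes σ Q x) q) + sum (λ x → elemWeight (σno σ Q x) q)
  ≡⟨ sym (cong₂ _+_ (weight≡sum q (σyes σ Q)) (weight≡sum q (σno σ Q))) ⟩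
    weight q (σyes σ Q) + weight q (σno σ Q)
  ∎
  where
  open ≡-Reasoning
  split : ∀ b v → elemWeight v (suc q) ≡
    elemWeight (if b then v else bump v) q + elemWeight (if b then bump v else v) q
  split true v = elemWeight-pascal v q
  split false v = trans (elemWeight-pascal v q) (+-comm (elemWeight v q) _)

length-support≡weight0 : ∀ {N} (σ : State N) → length (support σ) ≡ weight 0 σ
length-support≡weight0 σ = begin
    length (support σ)
  ≡⟨ length-filter-tabulate (λ x → val σ x ≤? 3) id ⟩
    sum (λ x → fromBool (does (val σ x ≤? 3)))
  ≡⟨ sum-cong-≗ (λ x → inSupport≡elemWeight0 (σ x)) ⟩
    sum (λ x → elemWeight (σ x) 0)
  ≡⟨ sym (weight≡sum 0 σ) ⟩
    weight 0 σ
  ∎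
  where
  open ≡-Reasoning
  inSupport≡elemWeight0 : ∀ v → fromBool (does (toℕ v ≤? 3)) ≡ elemWeight v 0
  inSupport≡elemWeight0 0F = refl
  inSupport≡elemWeight0 1F = refl
  inSupport≡elemWeight0 2F = refl
  inSupport≡elemWeight0 3F = refl
  inSupport≡elemWeight0 4F = refl

final-of-weight0 : ∀ {N} (σ : State N) → weight 0 σ ≤ 1 → Final σ
final-of-weight0 σ = subst (_≤ 1) (sym (length-support≡weight0 σ))

pointOrPrefix : ∀ {N} → Fin N → ℕ → Question N
pointOrPrefix e s x = does (x F.≟ e) ∨ does (toℕ x <? s)

module _ {N : ℕ} where

  pointInterval : Fin (suc N) → Interval (suc N)
  pointInterval e = interval (toℕ e) 1 (toℕ<n e) (s≤s z≤n)

  prefixInterval : ∀ s → s ≤ suc N → Interval (suc N)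
  prefixInterval s s≤1+N = interval 0 s (s≤s z≤n) s≤1+N

  emptyInterval : Interval (suc N)
  emptyInterval = interval 0 0 (s≤s z≤n) z≤n

  no-wraparound : ∀ {x b} → b ≤ suc N → ¬ (x + suc N < b)
  no-wraparound {x} b≤1+N x+1+N<b = <⇒≱ x+1+N<b (≤-trans b≤1+N (m≤n+m (suc N) x))

  ∈pointInterval : ∀ e → e ∈I pointInterval e
  ∈pointInterval e = inj₁ (≤-refl , ≤-reflexive (+-comm 1 (toℕ e)))

  ∈pointInterval⇒≡ : ∀ {x e} → x ∈I pointInterval e → x ≡ e
  ∈pointInterval⇒≡ {x} {e} (inj₁ (e≤x , x<e+1)) =
    toℕ-injective (≤-antisym (m<1+n⇒m≤n (subst (toℕ x <_) (+-comm (toℕ e) 1) x<e+1)) e≤x)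
  ∈pointInterval⇒≡ {x} {e} (inj₂ (_ , x+1+N<e+1)) = ⊥-elim (no-wraparound e+1≤1+N x+1+N<e+1)
    where
    e+1≤1+N : toℕ e + 1 ≤ suc N
    e+1≤1+N = subst (_≤ suc N) (+-comm 1 (toℕ e)) (toℕ<n e)

  ∈prefixInterval⇒< : ∀ {x s} (s≤1+N : s ≤ suc N) → x ∈I prefixInterval s s≤1+N → toℕ x < s
  ∈prefixInterval⇒< _ (inj₁ (_ , x<s)) = x<s
  ∈prefixInterval⇒< s≤1+N (inj₂ (_ , x+1+N<s)) = ⊥-elim (no-wraparound s≤1+N x+1+N<s)

  ∉emptyInterval : ∀ {x} → ¬ (x ∈I emptyInterval)
  ∉emptyInterval (inj₁ (_ , ()))
  ∉emptyInterval (inj₂ (_ , ()))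

pointOrPrefix-fourInterval : ∀ {N} (e : Fin N) s → s ≤ N → FourInterval (pointOrPrefix e s)
pointOrPrefix-fourInterval {suc N} e s s≤1+N =
  pointInterval e , prefixInterval s s≤1+N , emptyInterval , emptyInterval , λ x → to x , from x
  where
  to : ∀ x → pointOrPrefix e s x ≡ true → _
  to x with x F.≟ e | toℕ x <? s
  ... | yes refl | _ = λ _ → inj₁ (∈pointInterval x)
  ... | no _ | yes x<s = λ _ → inj₂ (inj₁ (inj₁ (z≤n , x<s)))
  -- the with above does not reach the goal, where does (toℕ x <? s) has reduced to toℕ x <ᵇ s
  ... | no _ | no x≮s = λ inQ → contradiction (trans (sym (dec-false (toℕ x <? s) x≮s)) inQ) λ ()
  from : ∀ x → _ → pointOrPrefix e s x ≡ true
  from x (inj₁ x∈point) = cong (_∨ does (toℕ x <? s)) (dec-true (x F.≟ e) (∈pointInterval⇒≡ x∈point))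
  from x (inj₂ (inj₁ x∈prefix)) =
    trans (cong (does (x F.≟ e) ∨_) (dec-true (toℕ x <? s) (∈prefixInterval⇒< s≤1+N x∈prefix)))
          (∨-zeroʳ (does (x F.≟ e)))
  from x (inj₂ (inj₂ (inj₁ x∈empty))) = ⊥-elim (∉emptyInterval x∈empty)
  from x (inj₂ (inj₂ (inj₂ x∈empty))) = ⊥-elim (∉emptyInterval x∈empty)

data Saturated : Fin 5 → Set where
  three : Saturated 3F
  four  : Saturated 4F

NearSaturatedAt : ∀ {N} → Fin N → State N → Set
NearSaturatedAt e σ = ∀ x → x ≢ e → Saturated (σ x)

bump-saturated : ∀ {v} → Saturated v → bump v ≡ 4F
bump-saturated three = refl
bump-saturated four = refl

saturated-bump : ∀ {v} → Saturated v → Saturated (bump v)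
saturated-bump three = four
saturated-bump four = four

if-saturated : ∀ b {v w} → Saturated v → Saturated w → Saturated (if b then v else w)
if-saturated true sv _ = sv
if-saturated false _ sw = sw

elemWeight-saturated : ∀ {v} → Saturated v → ∀ q → elemWeight v q ≡ elemWeight v 0
elemWeight-saturated three q = nC0≡1 q
elemWeight-saturated four q = refl

supportSizeExcept : ∀ {N} → State N → Fin N → ℕ
supportSizeExcept σ e = sum (dropAt e (λ x → elemWeight (σ x) 0))

weight-nearSaturated : ∀ {N} {e : Fin N} {σ : State N} → NearSaturatedAt e σ → ∀ q →
  weight q σ ≡ elemWeight (σ e) q + supportSizeExcept σ e
weight-nearSaturated {e = e} {σ} sat q = begin
    weight q σ
  ≡⟨ weight≡sum q σ ⟩
    sum (λ x → elemWeight (σ x) q)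
  ≡⟨ sum-dropAt e (λ x → elemWeight (σ x) q) ⟩
    elemWeight (σ e) q + sum (dropAt e (λ x → elemWeight (σ x) q))
  ≡⟨ cong (elemWeight (σ e) q +_)
       (sum-cong-≗ (dropAt-cong e (λ x x≢e → elemWeight-saturated (sat x x≢e) q))) ⟩
    elemWeight (σ e) q + supportSizeExcept σ e
  ∎
  where open ≡-Reasoning

prefixSum : ∀ {N} → ℕ → (Fin N → ℕ) → ℕ
prefixSum s h = sum (λ x → if does (toℕ x <? s) then h x else 0)

prefixSum-hits : ∀ {N} (h : Fin N → ℕ) → (∀ x → h x ≤ 1) →
  ∀ t → t ≤ sum h → ∃[ s ] s ≤ N × prefixSum s h ≡ t
prefixSum-hits {N} h _ zero _ = 0 , z≤n , sum-replicate-zero N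
prefixSum-hits {suc N} h h≤1 (suc t) 1+t≤sum
  with prefixSum-hits (h ∘ F.suc) (h≤1 ∘ F.suc) (suc t ∸ h 0F) (m≤n+o⇒m∸n≤o (suc t) (h 0F) 1+t≤sum)
... | s , s≤N , prefix≡ = suc s , s≤s s≤N , trans (cong (h 0F +_) prefix≡) (m+[n∸m]≡n h0≤1+t)
  where
  h0≤1+t : h 0F ≤ suc t
  h0≤1+t = ≤-trans (h≤1 0F) (s≤s z≤n)

module _ {N} {e : Fin N} {σ : State N} (sat : NearSaturatedAt e σ) (s : ℕ) where

  private
    Q = pointOrPrefix e s

  σyes-nearSaturated : NearSaturatedAt e (σyes σ Q)
  σyes-nearSaturated x x≢e with x F.≟ e
  ... | yes x≡e = ⊥-elim (x≢e x≡e)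
  ... | no _ = if-saturated (does (toℕ x <? s)) (sat x x≢e) (saturated-bump (sat x x≢e))

  σno-nearSaturated : NearSaturatedAt e (σno σ Q)
  σno-nearSaturated x x≢e with x F.≟ e
  ... | yes x≡e = ⊥-elim (x≢e x≡e)
  ... | no _ = if-saturated (does (toℕ x <? s)) (saturated-bump (sat x x≢e)) (sat x x≢e)

  weight-σyes : ∀ q → weight q (σyes σ Q) ≡ elemWeight (σ e) q + prefixSum s (dropAt e (λ x → elemWeight (σ x) 0))
  weight-σyes q = trans (weight-nearSaturated σyes-nearSaturated q)
                        (cong₂ (λ v o → elemWeight v q + o) σyes-at (sum-cong-≗ pointwise))
    where
    σyes-at : σyes σ Q e ≡ σ e
    σyes-at rewrite dec-true (e F.≟ e) refl = refl
    pointwise : ∀ x → dropAt e (λ x → elemWeight (σyes σ Q x) 0) x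
                    ≡ (if does (toℕ x <? s) then dropAt e (λ x → elemWeight (σ x) 0) x else 0)
    pointwise x with x F.≟ e
    ... | yes _ = sym (if-eta (does (toℕ x <? s)))
    ... | no x≢e = trans (if-float (λ v → elemWeight v 0) (does (toℕ x <? s)))
                         (if-cong-else (does (toℕ x <? s))
                           (cong (λ v → elemWeight v 0) (bump-saturated (sat x x≢e))))

-- A and A' are the weights of e after a yes and a no answer, P = 2^q, and the yes side keeps
-- t = k ⊓ (P ∸ A) of the k other 3's; by conservation the second conjunct bounds the no side by P.
budget-split : ∀ {A A' k P} → A ≤ P → A' ≤ P → A + A' + k ≤ P + P →
  A + k ⊓ (P ∸ A) ≤ P × A + A' + k ≤ (A + k ⊓ (P ∸ A)) + P
budget-split {A} {A'} {k} {P} A≤P A'≤P total =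
  ≤-trans (+-monoʳ-≤ A (m⊓n≤n k (P ∸ A))) (≤-reflexive (m+[n∸m]≡n A≤P)) , no-side (≤-total k (P ∸ A))
  where
  open +-*-Solver
  no-side : k ≤ P ∸ A ⊎ P ∸ A ≤ k → A + A' + k ≤ (A + k ⊓ (P ∸ A)) + P
  no-side (inj₁ k≤P∸A) rewrite m≤n⇒m⊓n≡m k≤P∸A =
    subst (_≤ (A + k) + P) (solve 3 (λ a a' k → (a :+ k) :+ a' := (a :+ a') :+ k) refl A A' k)
      (+-monoʳ-≤ (A + k) A'≤P)
  no-side (inj₂ P∸A≤k) rewrite m≥n⇒m⊓n≡n P∸A≤k | m+[n∸m]≡n A≤P = total

balanced-pointOrPrefix : ∀ {N} q {e : Fin N} {σ : State N} → NearSaturatedAt e σ →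
  weight (suc q) σ ≤ 2 ^ suc q →
  ∃[ s ] s ≤ N × weight q (σyes σ (pointOrPrefix e s)) ≤ 2 ^ q
                × weight q (σno σ (pointOrPrefix e s)) ≤ 2 ^ q
balanced-pointOrPrefix {N} q {e} {σ} sat w≤ =
  balanced (prefixSum-hits h (dropAt-≤ e (λ x → elemWeight0≤1 (σ x))) t (m⊓n≤m (sum h) (P ∸ A)))
  where
  A = elemWeight (σ e) q
  A' = elemWeight (bump (σ e)) q
  P = 2 ^ q
  h = dropAt e (λ x → elemWeight (σ x) 0)
  t = sum h ⊓ (P ∸ A)
  weight-suc : weight (suc q) σ ≡ A + A' + sum h
  weight-suc = trans (weight-nearSaturated sat (suc q)) (cong (_+ sum h) (elemWeight-pascal (σ e) q))
  budget = budget-split (elemWeight≤2^ (σ e) q) (elemWeight≤2^ (bump (σ e)) q)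
             (subst₂ _≤_ weight-suc (cong (P +_) (+-identityʳ P)) w≤)
  balanced : ∃[ s ] s ≤ N × prefixSum s h ≡ t →
    ∃[ s ] s ≤ N × weight q (σyes σ (pointOrPrefix e s)) ≤ P × weight q (σno σ (pointOrPrefix e s)) ≤ P
  balanced (s , s≤N , prefix≡t) =
    s , s≤N , subst (_≤ P) (sym weight-yes) (proj₁ budget) , +-cancelˡ-≤ (A + t) _ _ no≤
    where
    Q = pointOrPrefix e s
    weight-yes : weight q (σyes σ Q) ≡ A + t
    weight-yes = trans (weight-σyes sat s q) (cong (A +_) prefix≡t)
    no≤ : (A + t) + weight q (σno σ Q) ≤ (A + t) + P
    no≤ = begin
        (A + t) + weight q (σno σ Q)
      ≡⟨ cong (_+ weight q (σno σ Q)) (sym weight-yes) ⟩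
        weight q (σyes σ Q) + weight q (σno σ Q)
      ≡⟨ sym (weight-conservation q σ Q) ⟩
        weight (suc q) σ
      ≡⟨ weight-suc ⟩
        A + A' + sum h
      ≤⟨ proj₂ budget ⟩
        (A + t) + P
      ∎
      where open ≤-Reasoning

nearSaturated-strategy : ∀ q {N} {e : Fin N} {σ : State N} → NearSaturatedAt e σ → weight q σ ≤ 2 ^ q →
  Σ (Strategy N q) λ S → Winning σ S × Uses4Interval S
nearSaturated-strategy zero {σ = σ} _ w≤1 = leaf , final-of-weight0 σ w≤1 , tt
nearSaturated-strategy (suc q) sat w≤ with balanced-pointOrPrefix q sat w≤
... | s , s≤N , yes≤ , no≤ with nearSaturated-strategy q (σyes-nearSaturated sat s) yes≤
                               | nearSaturated-strategy q (σno-nearSaturated sat s) no≤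
...   | Syes , wins-yes , four-yes | Sno , wins-no , four-no =
  node (pointOrPrefix _ s) Syes Sno , (wins-yes , wins-no) ,
  (pointOrPrefix-fourInterval _ s s≤N , four-yes , four-no)

minimal-witness : ∀ {p} {P : Pred ℕ p} → Decidable P → ∀ n → P n → ∃[ q ] P q × (∀ r → r < q → ¬ P r)
minimal-witness {P = P} P? n Pn = search 0 n refl (λ _ ())
  where
  search : ∀ i fuel → i + fuel ≡ n → (∀ r → r < i → ¬ P r) → ∃[ q ] P q × (∀ r → r < q → ¬ P r)
  search i fuel _ below with P? i
  ... | yes Pi = i , Pi , below
  search i zero i+0≡n _ | no ¬Pi = ⊥-elim (¬Pi (subst P (trans (sym i+0≡n) (+-identityʳ i)) Pn))
  search i (suc fuel) i+1+fuel≡n below | no ¬Pi =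
    search (suc i) fuel (trans (sym (+-suc i fuel)) i+1+fuel≡n) below′
    where
    below′ : ∀ r → r < suc i → ¬ P r
    below′ r r<1+i with m≤n⇒m<n∨m≡n (m<1+n⇒m≤n r<1+i)
    ... | inj₁ r<i = below r r<i
    ... | inj₂ refl = ¬Pi

nearSaturated-ch : ∀ {N} {e : Fin N} {σ : State N} → NearSaturatedAt e σ → ∃[ q ] IsCh σ q
nearSaturated-ch {e = e} {σ} sat with minimal-witness (λ q → weight q σ ≤? 2 ^ q) (3 + k) witness
  where
  k = supportSizeExcept σ e
  witness : weight (3 + k) σ ≤ 2 ^ (3 + k)
  witness = begin
      weight (3 + k) σ
    ≡⟨ weight-nearSaturated sat (3 + k) ⟩
      elemWeight (σ e) (3 + k) + k
    ≤⟨ +-monoˡ-≤ k (elemWeight≤binSum3 (σ e) (3 + k)) ⟩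
      binSum (3 + k) 3 + k
    ≤⟨ binSum3+t≤2^ k ⟩
      2 ^ (3 + k)
    ∎
    where open ≤-Reasoning
... | q , w≤ , below = q , w≤ , λ p p<q → ≰⇒> (below p p<q)

unsaturated : Fin 5 → ℕ
unsaturated 0F = 1
unsaturated 1F = 1
unsaturated 2F = 1
unsaturated 3F = 0
unsaturated 4F = 0

count012≡sum-unsaturated : ∀ {N} (σ : State N) →
  count σ 0 + count σ 1 + count σ 2 ≡ sum (λ x → unsaturated (σ x))
count012≡sum-unsaturated {N} σ = begin
    count σ 0 + count σ 1 + count σ 2
  ≡⟨ cong₂ _+_ (cong₂ _+_ (count≡sum σ 0) (count≡sum σ 1)) (count≡sum σ 2) ⟩
    sum (c 0) + sum (c 1) + sum (c 2)
  ≡⟨ sym (trans (∑-distrib-+ (λ x → c 0 x + c 1 x) (c 2)) (cong (_+ sum (c 2)) (∑-distrib-+ (c 0) (c 1)))) ⟩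
    sum (λ x → c 0 x + c 1 x + c 2 x)
  ≡⟨ sum-cong-≗ (λ x → pointwise (σ x)) ⟩
    sum (λ x → unsaturated (σ x))
  ∎
  where
  open ≡-Reasoning
  c : ℕ → Fin N → ℕ
  c j x = fromBool (does (val σ x ≟ j))
  pointwise : ∀ v → fromBool (does (toℕ v ≟ 0)) + fromBool (does (toℕ v ≟ 1)) + fromBool (does (toℕ v ≟ 2))
                  ≡ unsaturated v
  pointwise 0F = refl
  pointwise 1F = refl
  pointwise 2F = refl
  pointwise 3F = refl
  pointwise 4F = refl

saturated? : ∀ v → Dec (Saturated v)
saturated? 0F = no λ ()
saturated? 1F = no λ ()
saturated? 2F = no λ ()
saturated? 3F = yes three
saturated? 4F = yes four

unsaturated≡1 : ∀ {v} → ¬ Saturated v → unsaturated v ≡ 1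
unsaturated≡1 {0F} _ = refl
unsaturated≡1 {1F} _ = refl
unsaturated≡1 {2F} _ = refl
unsaturated≡1 {3F} ¬sat = ⊥-elim (¬sat three)
unsaturated≡1 {4F} ¬sat = ⊥-elim (¬sat four)

unsaturated≡0⇒saturated : ∀ {v} → unsaturated v ≡ 0 → Saturated v
unsaturated≡0⇒saturated {3F} _ = three
unsaturated≡0⇒saturated {4F} _ = four

nearSaturated-of : ∀ {N} (σ : State N) → Fin N → sum (λ x → unsaturated (σ x)) ≤ 1 →
  ∃[ e ] NearSaturatedAt e σ
nearSaturated-of {N} σ x₀ few with all? (saturated? ∘ σ)
... | yes allSat = x₀ , λ x _ → allSat x
... | no ¬allSat with ¬∀⟶∃¬ N _ (saturated? ∘ σ) ¬allSat
...   | e , ¬sat-e = e , λ x x≢e →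
  unsaturated≡0⇒saturated (trans (sym (dropAt-≢ u x≢e)) (sum≡0⇒≡0 (dropAt e u) rest≡0 x))
  where
  u = λ x → unsaturated (σ x)
  1+rest≤1 : 1 + sum (dropAt e u) ≤ 1
  1+rest≤1 = subst (_≤ 1) (trans (sum-dropAt e u) (cong (_+ sum (dropAt e u)) (unsaturated≡1 ¬sat-e))) few
  rest≡0 : sum (dropAt e u) ≡ 0
  rest≡0 = n≤0⇒n≡0 (+-cancelˡ-≤ 1 _ _ 1+rest≤1)

AllThree : List ℕ → Set
AllThree = All (_≡ 3)

ThreesWithDefect : List ℕ → Set
ThreesWithDefect L = ∃[ A ] ∃[ j ] ∃[ B ] L ≡ A ++ j ∷ B × j < 3 × AllThree A × AllThree B

supportValuesOf : ∀ {N M} → State M → (Fin N → Fin M) → List ℕ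
supportValuesOf σ g = map (val σ) (filter (λ x → val σ x ≤? 3) (tabulate g))

supportValuesOf-suc : ∀ {N M} (σ : State M) (g : Fin (suc N) → Fin M) →
  supportValuesOf σ g ≡ (if does (val σ (g 0F) ≤? 3) then val σ (g 0F) ∷ supportValuesOf σ (g ∘ F.suc)
                                                      else supportValuesOf σ (g ∘ F.suc))
supportValuesOf-suc σ g with does (val σ (g 0F) ≤? 3)
... | true = refl
... | false = refl

allThree-supportValuesOf : ∀ {N M} (σ : State M) (g : Fin N → Fin M) →
  sum (λ i → unsaturated (σ (g i))) ≤ 0 → AllThree (supportValuesOf σ g)
allThree-supportValuesOf {zero} σ g _ = []
allThree-supportValuesOf {suc N} σ g none rewrite supportValuesOf-suc σ g with σ (g 0F)
... | 3F = refl ∷ allThree-supportValuesOf σ (g ∘ F.suc) none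
... | 4F = allThree-supportValuesOf σ (g ∘ F.suc) none

defect-supportValuesOf : ∀ {N M} (σ : State M) (g : Fin N → Fin M) {j} → j < 3 →
  sum (λ i → unsaturated (σ (g i))) ≤ 0 → ThreesWithDefect (j ∷ supportValuesOf σ g)
defect-supportValuesOf σ g {j} j<3 none = [] , j , _ , refl , j<3 , [] , allThree-supportValuesOf σ g none

shape-supportValuesOf : ∀ {N M} (σ : State M) (g : Fin N → Fin M) →
  sum (λ i → unsaturated (σ (g i))) ≤ 1 →
  AllThree (supportValuesOf σ g) ⊎ ThreesWithDefect (supportValuesOf σ g)
shape-supportValuesOf {zero} σ g _ = inj₁ []
shape-supportValuesOf {suc N} σ g few rewrite supportValuesOf-suc σ g with σ (g 0F)
... | 0F = inj₂ (defect-supportValuesOf σ (g ∘ F.suc) (s≤s z≤n) (≤-pred few))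
... | 1F = inj₂ (defect-supportValuesOf σ (g ∘ F.suc) (s≤s (s≤s z≤n)) (≤-pred few))
... | 2F = inj₂ (defect-supportValuesOf σ (g ∘ F.suc) ≤-refl (≤-pred few))
... | 4F = shape-supportValuesOf σ (g ∘ F.suc) few
... | 3F with shape-supportValuesOf σ (g ∘ F.suc) few
...   | inj₁ threes = inj₁ (refl ∷ threes)
...   | inj₂ (A , j , B , split , j<3 , threesA , threesB) =
  inj₂ (3 ∷ A , j , B , cong (3 ∷_) split , j<3 , refl ∷ threesA , threesB)

allThree⇒replicate : ∀ {L} → AllThree L → L ≡ replicate (length L) 3
allThree⇒replicate [] = refl
allThree⇒replicate (refl ∷ threes) = cong (3 ∷_) (allThree⇒replicate threes)

threes-blocks : ∀ r → ∃[ ls ] replicate r 3 ≡ blocks ls pattern₁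
threes-blocks r = (0 ∷ 0 ∷ 0 ∷ 0 ∷ 0 ∷ r ∷ 0 ∷ 0 ∷ 0 ∷ 0 ∷ 0 ∷ 0 ∷ []) , sym (++-identityʳ (replicate r 3))

defect-blocks : ∀ {j} → j < 3 → ∀ r → ∃[ ls ] j ∷ replicate r 3 ≡ blocks ls pattern₁
defect-blocks {0} _ r = (0 ∷ 0 ∷ 1 ∷ 0 ∷ 0 ∷ r ∷ 0 ∷ 0 ∷ 0 ∷ 0 ∷ 0 ∷ 0 ∷ []) , cong (0 ∷_) (proj₂ (threes-blocks r))
defect-blocks {1} _ r = (0 ∷ 1 ∷ 0 ∷ 0 ∷ 0 ∷ r ∷ 0 ∷ 0 ∷ 0 ∷ 0 ∷ 0 ∷ 0 ∷ []) , cong (1 ∷_) (proj₂ (threes-blocks r))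
defect-blocks {2} _ r = (1 ∷ 0 ∷ 0 ∷ 0 ∷ 0 ∷ r ∷ 0 ∷ 0 ∷ 0 ∷ 0 ∷ 0 ∷ 0 ∷ []) , cong (2 ∷_) (proj₂ (threes-blocks r))
defect-blocks {suc (suc (suc _))} (s≤s (s≤s (s≤s ()))) _

wellShaped : ∀ {N} (σ : State N) → sum (λ x → unsaturated (σ x)) ≤ 1 → WellShaped σ
wellShaped σ few with shape-supportValuesOf σ id few
... | inj₁ threes = supportValues σ , [] , sym (++-identityʳ (supportValues σ)) ,
  proj₁ blocks-ok , inj₁ (trans (allThree⇒replicate threes) (proj₂ blocks-ok))
  where blocks-ok = threes-blocks (length (supportValues σ))
... | inj₂ (A , j , B , split , j<3 , threesA , threesB) = A , j ∷ B , split ,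
  proj₁ blocks-ok , inj₁ (trans (cong (j ∷_) (allThree⇒replicate (++⁺ threesB threesA))) (proj₂ blocks-ok))
  where blocks-ok = defect-blocks j<3 (length (B ++ A))

fourIntervalNice-of-≤1-unsaturated : ∀ {N} (σ : State N) → Fin N →
  sum (λ x → unsaturated (σ x)) ≤ 1 → FourIntervalNice σ
fourIntervalNice-of-≤1-unsaturated σ x₀ few with nearSaturated-of σ x₀ few
... | e , sat with nearSaturated-ch sat
...   | q , isCh = wellShaped σ few , q , isCh , nearSaturated-strategy q sat (proj₁ isCh)

lemma8 : (m n : ℕ) (σ : State (2 ^ m)) →
    (HasType σ 1 0 0 n ⊎ HasType σ 0 1 0 n ⊎ HasType σ 0 0 1 n ⊎ HasType σ 0 0 0 n) →
    FourIntervalNice σ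
lemma8 m n σ type = fourIntervalNice-of-≤1-unsaturated σ (F.fromℕ< (m^n>0 2 m))
  (subst (_≤ 1) (count012≡sum-unsaturated σ) (count012≤1 type))
  where
  count012≤1 : (HasType σ 1 0 0 n ⊎ HasType σ 0 1 0 n ⊎ HasType σ 0 0 1 n ⊎ HasType σ 0 0 0 n) →
    count σ 0 + count σ 1 + count σ 2 ≤ 1
  count012≤1 (inj₁ (c₀ , c₁ , c₂ , _)) rewrite c₀ | c₁ | c₂ = ≤-refl
  count012≤1 (inj₂ (inj₁ (c₀ , c₁ , c₂ , _))) rewrite c₀ | c₁ | c₂ = ≤-refl
  count012≤1 (inj₂ (inj₂ (inj₁ (c₀ , c₁ , c₂ , _)))) rewrite c₀ | c₁ | c₂ = ≤-refl
  count012≤1 (inj₂ (inj₂ (inj₂ (c₀ , c₁ , c₂ , _)))) rewrite c₀ | c₁ | c₂ = z≤n
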